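{- Let $k \geq 2$, $n \geq 2$ and $\lambda \geq 1$ be integers, and let $1$ be one of the symbols. Suppose $A$ is an orthogonal array $\mathrm{OA}_{\lambda}(k,n)$ that contains the all-ones row $(1, 1, \ldots, 1)$ exactly in (at least) $m$ rows, where $m = \lambda n^2/(k(n-1)+1)$. Then each of the remaining $\lambda n^2 - m$ rows of $A$ (i.e. each row other than these $m$ copies of the all-ones row) contains exactly \[\overline{a} = \frac{k(\lambda n - m)}{\lambda n^2 - m}\] occurrences of the symbol $1$.
   Context: An orthogonal array $\mathrm{OA}_{\lambda}(k,n)$ (of strength two) is a $\lambda n^2$ by $k$ array $A$ with entries from a set $X$ of cardinality $n$ such that, within any two columns of $A$, every ordered pair of symbols from $X$ occurs in exactly $\lambda$ rows of $A$. -}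

module Defs where

open import Data.Nat using (ℕ; zero; suc; _+_; _*_; _^_)
open import Data.Fin using (Fin; zero; suc)
open import Relation.Nullary using (Dec; yes; no)
open import Relation.Binary.PropositionalEquality using (_≡_; _≢_)
open import Relation.Nullary.Decidable using (_×-dec_)
import Data.Fin

count : ∀ {N} {P : Fin N → Set} → ((i : Fin N) → Dec (P i)) → ℕ
count {zero} d = 0
count {suc N} d with d zero
... | yes _ = suc (count (λ i → d (suc i)))
... | no _ = count (λ i → d (suc i))

-- an orthogonal array OA_λ(k,n): λ n² rows, k columns, symbols Fin n
Array : ℕ → ℕ → ℕ → Set
Array λ' k n = Fin (λ' * n ^ 2) → Fin k → Fin n

IsOA : ∀ λ' k n → Array λ' k n → Set
IsOA λ' k n A =
  (c d : Fin k) → c ≢ d → (x y : Fin n) →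
  count (λ r → Data.Fin._≟_ (A r c) x ×-dec Data.Fin._≟_ (A r d) y) ≡ λ'

module Submission where

-- Let a(r) be the number of occurrences of the symbol 1 in row r of an
-- OA_λ(k,n) with N = λn² rows.  Double counting over the columns gives the
-- first two moments of a:  ∑ a = kλn  and  ∑ a² = kλn + k(k-1)λ.
-- Removing the m all-ones rows (each with a = k) leaves M = N - m rows with
--   ∑' a = Y = k(λn - m)   and   ∑' a² = V = k(kλ + λn) - kλ - mk².
-- A polynomial identity (checked over ℤ) shows that the hypothesis
-- m(k(n-1)+1) = λn² is exactly what makes  M·V = Y², i.e. the
-- Cauchy–Schwarz inequality (∑' 1)(∑' a²) ≥ (∑' a)² is an equality.
-- In its equality case every remaining row has M·a(r) = Y, which is the claim.

module MomentBalance where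
  open import Data.Integer using (ℤ; +_; 0ℤ; 1ℤ; _+_; _-_; _*_; -_)
  open import Data.Integer.Properties using (pos-*; +-injective; +-assoc; +-inverseʳ; +-identityʳ; *-zeroʳ)
  open import Data.Integer.Tactic.RingSolver using (solve-∀)
  import Data.Nat as ℕ
  import Data.Nat.Properties as ℕ
  open import Relation.Binary.PropositionalEquality
  open ≡-Reasoning

  -- With n = 1 + n', L = λn², M = L - m, Y = kλn - mk and V = k(kλ + λn) - kλ - mk²,
  -- the Cauchy–Schwarz defect M·V - Y² equals kn'λ·(L - m(kn' + 1)).
  defect : ∀ l m n' k → let n = 1ℤ + n' ; L = l * (n * n) in
    (L - m) * (k * (k * l + l * n) - k * l - m * (k * k))
    ≡ (k * (l * n) - m * k) * (k * (l * n) - m * k) + k * n' * l * (L - m * (k * n' + 1ℤ))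
  defect = solve-∀

  solve-for : ∀ {a b c : ℤ} → a + b ≡ c → a ≡ c - b
  solve-for {a} {b} refl = sym (begin
    a + b - b     ≡⟨ +-assoc a b (- b) ⟩
    a + (b - b)   ≡⟨ cong (λ t → a + t) (+-inverseʳ b) ⟩
    a + 0ℤ        ≡⟨ +-identityʳ a ⟩
    a ∎)

  pos-*³ : ∀ a b c → + (a ℕ.* (b ℕ.* c)) ≡ + a * (+ b * + c)
  pos-*³ a b c = trans (pos-* a (b ℕ.* c)) (cong (λ t → + a * t) (pos-* b c))

  -- The ℕ form: the removed-row moments M, Y, V (given by their defining
  -- equations without ∸) satisfy M·V = Y² under m(kn' + 1) = λn².
  balance : ∀ l m n' k M Y V → let n = ℕ.suc n' in
    M ℕ.+ m ≡ l ℕ.* n ℕ.^ 2 →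
    Y ℕ.+ m ℕ.* k ≡ k ℕ.* (l ℕ.* n) →
    V ℕ.+ m ℕ.* (k ℕ.* k) ℕ.+ k ℕ.* l ≡ k ℕ.* (k ℕ.* l ℕ.+ l ℕ.* n) →
    m ℕ.* (k ℕ.* n' ℕ.+ 1) ≡ l ℕ.* n ℕ.^ 2 →
    M ℕ.* V ≡ Y ℕ.* Y
  balance l m n' k M Y V hM hY hV hm = +-injective (begin
    + (M ℕ.* V)                      ≡⟨ pos-* M V ⟩
    + M * + V                        ≡⟨ cong₂ _*_ M≡ V≡ ⟩
    (L - ṁ) * (K - k̃ * l̃ - ṁ * (k̃ * k̃))
                                     ≡⟨ defect l̃ ṁ (+ n') k̃ ⟩
    Ỹ * Ỹ + k̃ * + n' * l̃ * (L - ṁ * (k̃ * + n' + 1ℤ))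
                                     ≡⟨ cong (λ t → Ỹ * Ỹ + k̃ * + n' * l̃ * t) vanishes ⟩
    Ỹ * Ỹ + k̃ * + n' * l̃ * 0ℤ      ≡⟨ trans (cong (λ t → Ỹ * Ỹ + t) (*-zeroʳ (k̃ * + n' * l̃))) (+-identityʳ (Ỹ * Ỹ)) ⟩
    Ỹ * Ỹ                            ≡⟨ sym (cong₂ _*_ Y≡ Y≡) ⟩
    + Y * + Y                        ≡⟨ sym (pos-* Y Y) ⟩
    + (Y ℕ.* Y) ∎)
    where
    n = ℕ.suc n'
    l̃ = + l
    ṁ = + m
    k̃ = + k
    ñ = 1ℤ + + n'
    L = l̃ * (ñ * ñ)
    K = k̃ * (k̃ * l̃ + l̃ * ñ)
    Ỹ = k̃ * (l̃ * ñ) - ṁ * k̃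
    cast-L : + (l ℕ.* n ℕ.^ 2) ≡ L
    cast-L = trans (cong (λ t → + (l ℕ.* (n ℕ.* t))) (ℕ.*-identityʳ n)) (pos-*³ l n n)
    M≡ : + M ≡ L - ṁ
    M≡ = solve-for (trans (cong +_ hM) cast-L)
    Y≡ : + Y ≡ Ỹ
    Y≡ = solve-for (trans (cong (λ t → + Y + t) (sym (pos-* m k))) (trans (cong +_ hY) (pos-*³ k l n)))
    V≡ : + V ≡ K - k̃ * l̃ - ṁ * (k̃ * k̃)
    V≡ = solve-for (solve-for (begin
      + V + ṁ * (k̃ * k̃) + k̃ * l̃          ≡⟨ sym (cong₂ (λ a b → + V + a + b) (pos-*³ m k k) (pos-* k l)) ⟩
      + (V ℕ.+ m ℕ.* (k ℕ.* k) ℕ.+ k ℕ.* l) ≡⟨ cong +_ hV ⟩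
      + (k ℕ.* (k ℕ.* l ℕ.+ l ℕ.* n))      ≡⟨ trans (pos-* k _) (cong (k̃ *_) (cong₂ _+_ (pos-* k l) (pos-* l n))) ⟩
      K ∎))
    vanishes : L - ṁ * (k̃ * + n' + 1ℤ) ≡ 0ℤ
    vanishes = begin
      L - ṁ * (k̃ * + n' + 1ℤ) ≡⟨ cong (λ t → L - t) (trans (sym (trans (pos-* m _) (cong (λ t → ṁ * (t + 1ℤ)) (pos-* k n')))) (trans (cong +_ hm) cast-L)) ⟩
      L - L ≡⟨ +-inverseʳ L ⟩
      0ℤ ∎

open import Defs
open import Data.Nat using (ℕ; zero; suc; _+_; _*_; _∸_; _^_; _≥_; _≤_; s≤s; z≤n; ≢-nonZero)
open import Data.Nat.Properties hiding (_≟_)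
open import Data.Nat.Tactic.RingSolver using (solve-∀)
open import Data.Fin using (Fin; _≟_; zero; suc)
open import Data.Fin.Properties using () renaming (0≢1+n to fzero≢fsuc; suc-injective to fsuc-injective)
open import Data.Bool using (if_then_else_)
open import Data.Product using (∃-syntax; _,_)
open import Function using (_∘_)
open import Function.Definitions using (Injective)
open import Relation.Nullary using (Dec; does; yes; no; ¬_; contradiction)
open import Relation.Nullary.Decidable using (_×-dec_)
open import Relation.Binary.PropositionalEquality
open import Algebra.Properties.Semiring.Sum +-*-semiring
  using (sum; sum-syntax; sum-cong-≗; sum-replicate-zero; ∑-distrib-+; ∑-comm; *-distribˡ-sum; *-distribʳ-sum)
open ≡-Reasoning

𝟙 : ∀ {p} {P : Set p} → Dec P → ℕ
𝟙 d = if does d then 1 else 0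

𝟙-yes : ∀ {p} {P : Set p} → P → (d : Dec P) → 𝟙 d ≡ 1
𝟙-yes _ (yes _) = refl
𝟙-yes p (no ¬p) = contradiction p ¬p

𝟙-no : ∀ {p} {P : Set p} → ¬ P → (d : Dec P) → 𝟙 d ≡ 0
𝟙-no ¬p (yes p) = contradiction p ¬p
𝟙-no ¬p (no _) = refl

𝟙-× : ∀ {P Q : Set} (a : Dec P) (b : Dec Q) → 𝟙 (a ×-dec b) ≡ 𝟙 a * 𝟙 b
𝟙-× (yes _) b = sym (+-identityʳ (𝟙 b))
𝟙-× (no _) b = refl

-- Indicators are idempotent; this turns ∑ 𝟙² into a plain count.
𝟙-idem : ∀ {P : Set} (a : Dec P) → 𝟙 a * 𝟙 a ≡ 𝟙 a
𝟙-idem (yes _) = refl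
𝟙-idem (no _) = refl

count≡∑ : ∀ {N} {P : Fin N → Set} (d : (i : Fin N) → Dec (P i)) → count d ≡ ∑[ i < N ] 𝟙 (d i)
count≡∑ {zero} d = refl
count≡∑ {suc N} d with d zero
... | yes _ = cong suc (count≡∑ (d ∘ suc))
... | no _ = count≡∑ (d ∘ suc)

∑-const : ∀ N (c : ℕ) → ∑[ i < N ] c ≡ N * c
∑-const zero c = refl
∑-const (suc N) c = cong (c +_) (∑-const N c)

∑-+-const : ∀ {N} (f : Fin N → ℕ) (c : ℕ) → ∑[ i < N ] (f i + c) ≡ sum f + N * c
∑-+-const {N} f c = trans (∑-distrib-+ f (λ _ → c)) (cong (sum f +_) (∑-const N c))

sift : ∀ {N} (a : Fin N) (g : Fin N → ℕ) → ∑[ i < N ] (𝟙 (a ≟ i) * g i) ≡ g a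
sift {suc N} zero g = begin
  (g zero + 0) + ∑[ i < N ] 0 ≡⟨ cong₂ _+_ (+-identityʳ (g zero)) (sum-replicate-zero N) ⟩
  g zero + 0 ≡⟨ +-identityʳ (g zero) ⟩
  g zero ∎
sift {suc N} (suc a) g = sift a (g ∘ suc)

∑-δ : ∀ {N} (a : Fin N) → ∑[ i < N ] 𝟙 (a ≟ i) ≡ 1
∑-δ {N} a = trans (sum-cong-≗ (λ i → sym (*-identityʳ (𝟙 (a ≟ i))))) (sift a (λ _ → 1))

∑-square : ∀ {N} (x : Fin N → ℕ) → sum x * sum x ≡ ∑[ c < N ] ∑[ d < N ] (x c * x d)
∑-square x = trans (*-distribʳ-sum (sum x) x) (sum-cong-≗ (λ c → *-distribˡ-sum (x c) x))

∑-mono-≤ : ∀ {N} {f g : Fin N → ℕ} → (∀ i → f i ≤ g i) → sum f ≤ sum g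
∑-mono-≤ {zero} le = z≤n
∑-mono-≤ {suc N} le = +-mono-≤ (le zero) (∑-mono-≤ (le ∘ suc))

+-tight : ∀ {a b c d} → a ≤ b → c ≤ d → b + d ≡ a + c → b ≡ a
+-tight {a} {b} {c} {d} a≤b c≤d e = ≤-antisym b≤a a≤b
  where
  b≤a : b ≤ a
  b≤a = +-cancelʳ-≤ d b a (≤-trans (≤-reflexive e) (+-monoʳ-≤ a c≤d))

∑-tight : ∀ {N} {f g : Fin N → ℕ} → (∀ i → f i ≤ g i) → sum g ≡ sum f → ∀ i → g i ≡ f i
∑-tight {suc N} le e zero = +-tight (le zero) (∑-mono-≤ (le ∘ suc)) e
∑-tight {suc N} {f} {g} le e (suc i) = ∑-tight (le ∘ suc) rest-equal i
  where
  rest-equal : sum (g ∘ suc) ≡ sum (f ∘ suc)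
  rest-equal = +-cancelˡ-≡ (g zero) _ _
    (trans e (cong (_+ sum (f ∘ suc)) (sym (+-tight (le zero) (∑-mono-≤ (le ∘ suc)) e))))

multiplicity : ∀ {m N} → (Fin m → Fin N) → Fin N → ℕ
multiplicity {m} f r = ∑[ i < m ] 𝟙 (f i ≟ r)

∑-multiplicity : ∀ {m N} (f : Fin m → Fin N) (g : Fin N → ℕ) →
  ∑[ r < N ] (multiplicity f r * g r) ≡ ∑[ i < m ] g (f i)
∑-multiplicity {m} {N} f g = begin
  ∑[ r < N ] (multiplicity f r * g r)      ≡⟨ sum-cong-≗ (λ r → *-distribʳ-sum (g r) (λ i → 𝟙 (f i ≟ r))) ⟩
  ∑[ r < N ] ∑[ i < m ] (𝟙 (f i ≟ r) * g r) ≡⟨ ∑-comm (λ r i → 𝟙 (f i ≟ r) * g r) ⟩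
  ∑[ i < m ] ∑[ r < N ] (𝟙 (f i ≟ r) * g r) ≡⟨ sum-cong-≗ (λ i → sift (f i) g) ⟩
  ∑[ i < m ] g (f i)                        ∎

multiplicity≤1 : ∀ {m N} (f : Fin m → Fin N) → Injective _≡_ _≡_ f → ∀ r → multiplicity f r ≤ 1
multiplicity≤1 {zero} f inj r = z≤n
multiplicity≤1 {suc m} f inj r with f zero ≟ r
... | yes f0≡r = s≤s (≤-reflexive (trans (sum-cong-≗ missed) (sum-replicate-zero m)))
  where
  missed : ∀ i → 𝟙 (f (suc i) ≟ r) ≡ 0
  missed i = 𝟙-no (λ fi≡r → fzero≢fsuc (inj (trans f0≡r (sym fi≡r)))) (f (suc i) ≟ r)
... | no _ = multiplicity≤1 (f ∘ suc) (fsuc-injective ∘ inj) r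

multiplicity≡0 : ∀ {m N} (f : Fin m → Fin N) r → (∀ i → f i ≢ r) → multiplicity f r ≡ 0
multiplicity≡0 {m} f r missed = trans (sum-cong-≗ (λ i → 𝟙-no (missed i) (f i ≟ r))) (sum-replicate-zero m)

-- For injective f, outside f r is the indicator of r not being in the image of f.
outside : ∀ {m N} → (Fin m → Fin N) → Fin N → ℕ
outside f r = 1 ∸ multiplicity f r

outside+multiplicity : ∀ {m N} (f : Fin m → Fin N) → Injective _≡_ _≡_ f → ∀ r →
  outside f r + multiplicity f r ≡ 1
outside+multiplicity f inj r = m∸n+n≡m (multiplicity≤1 f inj r)

∑-outside : ∀ {m N} (f : Fin m → Fin N) → Injective _≡_ _≡_ f →
  (g : Fin N → ℕ) (c : ℕ) → (∀ i → g (f i) ≡ c) →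
  ∑[ r < N ] (outside f r * g r) + m * c ≡ sum g
∑-outside {m} {N} f inj g c g∘f≡c = begin
  ∑[ r < N ] (outside f r * g r) + m * c
    ≡⟨ cong (∑[ r < N ] (outside f r * g r) +_) (trans (sym (∑-const m c)) (sym (trans (∑-multiplicity f g) (sum-cong-≗ g∘f≡c)))) ⟩
  ∑[ r < N ] (outside f r * g r) + ∑[ r < N ] (multiplicity f r * g r)
    ≡⟨ sym (∑-distrib-+ (λ r → outside f r * g r) (λ r → multiplicity f r * g r)) ⟩
  ∑[ r < N ] (outside f r * g r + multiplicity f r * g r)
    ≡⟨ sum-cong-≗ (λ r → trans (sym (*-distribʳ-+ (g r) (outside f r) (multiplicity f r)))
                            (trans (cong (_* g r) (outside+multiplicity f inj r)) (*-identityˡ (g r)))) ⟩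
  sum g ∎

∑-outside-count : ∀ {m N} (f : Fin m → Fin N) → Injective _≡_ _≡_ f →
  ∑[ r < N ] outside f r + m ≡ N
∑-outside-count {m} {N} f inj = begin
  ∑[ r < N ] outside f r + m
    ≡⟨ cong₂ _+_ (sum-cong-≗ (λ r → sym (*-identityʳ (outside f r)))) (sym (*-identityʳ m)) ⟩
  ∑[ r < N ] (outside f r * 1) + m * 1 ≡⟨ ∑-outside f inj (λ _ → 1) 1 (λ _ → refl) ⟩
  ∑[ r < N ] 1                          ≡⟨ trans (∑-const N 1) (*-identityʳ N) ⟩
  N ∎

private
  square-step : ∀ x y → (1 + x) * (1 + x) + (1 + y) * (1 + y) ≡ (x * x + y * y) + (2 + 2 * x + 2 * y)
  square-step = solve-∀
  product-step : ∀ x y → 2 * ((1 + x) * (1 + y)) ≡ 2 * (x * y) + (2 + 2 * x + 2 * y)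
  product-step = solve-∀

am-gm : ∀ x y → 2 * (x * y) ≤ x * x + y * y
am-gm zero y = z≤n
am-gm (suc x) zero rewrite *-zeroʳ x = z≤n
am-gm (suc x) (suc y) rewrite square-step x y | product-step x y = +-monoˡ-≤ _ (am-gm x y)

am-gm-equality : ∀ x y → x * x + y * y ≡ 2 * (x * y) → x ≡ y
am-gm-equality zero zero e = refl
am-gm-equality zero (suc y) ()
am-gm-equality (suc x) zero e rewrite *-zeroʳ x | +-identityʳ (x + x * suc x) = contradiction e 1+n≢0
am-gm-equality (suc x) (suc y) e =
  cong suc (am-gm-equality x y (+-cancelʳ-≡ _ _ _ (trans (sym (square-step x y)) (trans e (product-step x y)))))

-- Proof: ∑ w ((M a)² + Y²) = M(MV + Y²) = 2MY² = ∑ w·2(Ma)Y,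
-- and AM–GM forces each weighted term to be tight.
cauchy-schwarz-equality : ∀ {N} (w a : Fin N → ℕ) →
  let M = sum w ; Y = ∑[ r < N ] (w r * a r) ; V = ∑[ r < N ] (w r * (a r * a r)) in
  M * V ≡ Y * Y → ∀ r → w r ≢ 0 → M * a r ≡ Y
cauchy-schwarz-equality {N} w a MV≡YY r wr≢0 =
  am-gm-equality (M * a r) Y (*-cancelˡ-≡ _ _ (w r) {{≢-nonZero wr≢0}} (∑-tight T≥U ∑T≡∑U r))
  where
  M = sum w
  Y = ∑[ r < N ] (w r * a r)
  V = ∑[ r < N ] (w r * (a r * a r))
  T U : Fin N → ℕ
  T r = w r * ((M * a r) * (M * a r) + Y * Y)
  U r = w r * (2 * ((M * a r) * Y))
  T≥U : ∀ r → U r ≤ T r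
  T≥U r = *-monoʳ-≤ (w r) (am-gm (M * a r) Y)
  expand-T : ∀ w M a Y → w * (M * a * (M * a) + Y * Y) ≡ M * M * (w * (a * a)) + Y * Y * w
  expand-T = solve-∀
  expand-U : ∀ w M a Y → w * (2 * (M * a * Y)) ≡ 2 * M * Y * (w * a)
  expand-U = solve-∀
  double : ∀ M Y → M * (Y * Y) + Y * Y * M ≡ 2 * M * Y * Y
  double = solve-∀
  ∑T≡∑U : sum T ≡ sum U
  ∑T≡∑U = begin
    sum T ≡⟨ sum-cong-≗ (λ r → expand-T (w r) M (a r) Y) ⟩
    ∑[ r < N ] (M * M * (w r * (a r * a r)) + Y * Y * w r)
      ≡⟨ ∑-distrib-+ (λ r → M * M * (w r * (a r * a r))) (λ r → Y * Y * w r) ⟩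
    ∑[ r < N ] (M * M * (w r * (a r * a r))) + ∑[ r < N ] (Y * Y * w r)
      ≡⟨ cong₂ _+_ (sym (*-distribˡ-sum (M * M) (λ r → w r * (a r * a r)))) (sym (*-distribˡ-sum (Y * Y) w)) ⟩
    M * M * V + Y * Y * M ≡⟨ cong (_+ Y * Y * M) (trans (*-assoc M M V) (cong (M *_) MV≡YY)) ⟩
    M * (Y * Y) + Y * Y * M ≡⟨ double M Y ⟩
    2 * M * Y * Y ≡⟨ *-distribˡ-sum (2 * M * Y) (λ r → w r * a r) ⟩
    ∑[ r < N ] (2 * M * Y * (w r * a r)) ≡⟨ sum-cong-≗ (λ r → sym (expand-U (w r) M (a r) Y)) ⟩
    sum U ∎

partner : ∀ {k} → 2 ≤ k → (c : Fin k) → ∃[ d ] c ≢ d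
partner (s≤s (s≤s _)) zero = suc zero , λ ()
partner (s≤s (s≤s _)) (suc c) = zero , λ ()

module SymbolCounts {λ' k n : ℕ} (A : Array λ' k n) (isOA : IsOA λ' k n A)
                    (two-columns : 2 ≤ k) (s : Fin n) where

  N : ℕ
  N = λ' * n ^ 2

  hit : Fin N → Fin k → ℕ
  hit r c = 𝟙 (A r c ≟ s)

  weight : Fin N → ℕ
  weight r = count (λ c → A r c ≟ s)

  weight≡∑ : ∀ r → weight r ≡ ∑[ c < k ] hit r c
  weight≡∑ r = count≡∑ (λ c → A r c ≟ s)

  constant-row : ∀ r → (∀ c → A r c ≡ s) → weight r ≡ k
  constant-row r all-s =
    trans (weight≡∑ r) (trans (sum-cong-≗ (λ c → 𝟙-yes (all-s c) (A r c ≟ s))) (trans (∑-const k 1) (*-identityʳ k)))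

  pair-count : ∀ c d → c ≢ d → (y : Fin n) → ∑[ r < N ] (hit r c * 𝟙 (A r d ≟ y)) ≡ λ'
  pair-count c d c≢d y = begin
    ∑[ r < N ] (hit r c * 𝟙 (A r d ≟ y)) ≡⟨ sum-cong-≗ (λ r → sym (𝟙-× (A r c ≟ s) (A r d ≟ y))) ⟩
    ∑[ r < N ] 𝟙 ((A r c ≟ s) ×-dec (A r d ≟ y)) ≡⟨ sym (count≡∑ (λ r → (A r c ≟ s) ×-dec (A r d ≟ y))) ⟩
    count (λ r → (A r c ≟ s) ×-dec (A r d ≟ y)) ≡⟨ isOA c d c≢d s y ⟩
    λ' ∎

  -- Each column contains s exactly λn times: sum pair-count over the symbols y
  -- of a partner column.
  column-count : ∀ c → ∑[ r < N ] hit r c ≡ λ' * n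
  column-count c with partner two-columns c
  ... | d , c≢d = begin
    ∑[ r < N ] hit r c                                   ≡⟨ sum-cong-≗ (λ r → sym (trans (cong (hit r c *_) (∑-δ (A r d))) (*-identityʳ (hit r c)))) ⟩
    ∑[ r < N ] (hit r c * ∑[ y < n ] 𝟙 (A r d ≟ y))    ≡⟨ sum-cong-≗ (λ r → *-distribˡ-sum (hit r c) (λ y → 𝟙 (A r d ≟ y))) ⟩
    ∑[ r < N ] ∑[ y < n ] (hit r c * 𝟙 (A r d ≟ y))    ≡⟨ ∑-comm (λ r y → hit r c * 𝟙 (A r d ≟ y)) ⟩
    ∑[ y < n ] ∑[ r < N ] (hit r c * 𝟙 (A r d ≟ y))    ≡⟨ sum-cong-≗ (pair-count c d c≢d) ⟩
    ∑[ y < n ] λ'                                        ≡⟨ trans (∑-const n λ') (*-comm n λ') ⟩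
    λ' * n ∎

  co-occurrences : Fin k → Fin k → ℕ
  co-occurrences c d = ∑[ r < N ] (hit r c * hit r d)

  -- It is λ off the diagonal and λn on it; the correction by 𝟙 (c ≟ d) keeps ℕ.
  co-occurrences-δ : ∀ c d → co-occurrences c d + 𝟙 (c ≟ d) * λ' ≡ λ' + 𝟙 (c ≟ d) * (λ' * n)
  co-occurrences-δ c d with c ≟ d
  ... | yes refl = begin
    co-occurrences c c + (λ' + 0) ≡⟨ cong₂ _+_ (trans (sum-cong-≗ (λ r → 𝟙-idem (A r c ≟ s))) (column-count c)) (+-identityʳ λ') ⟩
    λ' * n + λ'                   ≡⟨ +-comm (λ' * n) λ' ⟩
    λ' + λ' * n                   ≡⟨ cong (λ' +_) (sym (+-identityʳ (λ' * n))) ⟩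
    λ' + (λ' * n + 0) ∎
  ... | no c≢d = trans (+-identityʳ _) (trans (pair-count c d c≢d s) (sym (+-identityʳ λ')))

  first-moment : ∑[ r < N ] weight r ≡ k * (λ' * n)
  first-moment = begin
    ∑[ r < N ] weight r             ≡⟨ sum-cong-≗ weight≡∑ ⟩
    ∑[ r < N ] ∑[ c < k ] hit r c   ≡⟨ ∑-comm hit ⟩
    ∑[ c < k ] ∑[ r < N ] hit r c   ≡⟨ sum-cong-≗ column-count ⟩
    ∑[ c < k ] (λ' * n)             ≡⟨ ∑-const k (λ' * n) ⟩
    k * (λ' * n) ∎

  -- Summing co-occurrences along a column: λ(k - 1) + λn, written without ∸.
  co-occurrence-row : ∀ c → ∑[ d < k ] co-occurrences c d + λ' ≡ k * λ' + λ' * n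
  co-occurrence-row c = begin
    ∑[ d < k ] co-occurrences c d + λ'
      ≡⟨ cong (∑[ d < k ] co-occurrences c d +_) (sym (sift c (λ _ → λ'))) ⟩
    ∑[ d < k ] co-occurrences c d + ∑[ d < k ] (𝟙 (c ≟ d) * λ')
      ≡⟨ sym (∑-distrib-+ (co-occurrences c) (λ d → 𝟙 (c ≟ d) * λ')) ⟩
    ∑[ d < k ] (co-occurrences c d + 𝟙 (c ≟ d) * λ')
      ≡⟨ sum-cong-≗ (co-occurrences-δ c) ⟩
    ∑[ d < k ] (λ' + 𝟙 (c ≟ d) * (λ' * n))
      ≡⟨ ∑-distrib-+ (λ _ → λ') (λ d → 𝟙 (c ≟ d) * (λ' * n)) ⟩
    ∑[ d < k ] λ' + ∑[ d < k ] (𝟙 (c ≟ d) * (λ' * n))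
      ≡⟨ cong₂ _+_ (∑-const k λ') (sift c (λ _ → λ' * n)) ⟩
    k * λ' + λ' * n ∎

  -- Second moment: ∑ weight² = kλn + k(k - 1)λ, written without ∸.
  second-moment : ∑[ r < N ] (weight r * weight r) + k * λ' ≡ k * (k * λ' + λ' * n)
  second-moment = begin
    ∑[ r < N ] (weight r * weight r) + k * λ'
      ≡⟨ cong (_+ k * λ') (sum-cong-≗ (λ r → trans (cong₂ _*_ (weight≡∑ r) (weight≡∑ r)) (∑-square (hit r)))) ⟩
    ∑[ r < N ] ∑[ c < k ] ∑[ d < k ] (hit r c * hit r d) + k * λ'
      ≡⟨ cong (_+ k * λ') (trans (∑-comm (λ r c → ∑[ d < k ] (hit r c * hit r d))) (sum-cong-≗ (λ c → ∑-comm (λ r d → hit r c * hit r d)))) ⟩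
    ∑[ c < k ] ∑[ d < k ] co-occurrences c d + k * λ'
      ≡⟨ sym (∑-+-const (λ c → ∑[ d < k ] co-occurrences c d) λ') ⟩
    ∑[ c < k ] (∑[ d < k ] co-occurrences c d + λ')
      ≡⟨ sum-cong-≗ co-occurrence-row ⟩
    ∑[ c < k ] (k * λ' + λ' * n)
      ≡⟨ ∑-const k (k * λ' + λ' * n) ⟩
    k * (k * λ' + λ' * n) ∎

open MomentBalance using (balance)

corollary2p7 : (k n λ' m : ℕ) → k ≥ 2 → n ≥ 2 → λ' ≥ 1 →
    m * (k * (n ∸ 1) + 1) ≡ λ' * n ^ 2 →
    (A : Array λ' k n) → IsOA λ' k n A →
    (one : Fin n) →
    (ones : Fin m → Fin (λ' * n ^ 2)) → Injective _≡_ _≡_ ones →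
    (∀ i c → A (ones i) c ≡ one) →
    (r : Fin (λ' * n ^ 2)) → (∀ i → ones i ≢ r) →
    count (λ c → A r c ≟ one) * (λ' * n ^ 2 ∸ m) ≡ k * (λ' * n ∸ m)
corollary2p7 k (suc n') λ' m k≥2 _ _ hyp A isOA one ones inj all-ones r not-one = begin
  weight r * (N ∸ m) ≡⟨ cong (weight r *_) N∸m≡M ⟩
  weight r * M       ≡⟨ *-comm (weight r) M ⟩
  M * weight r       ≡⟨ cauchy-schwarz-equality w weight (balance λ' m n' k M Y V M+m Y+mk V+mk²+kλ hyp) r w-r≢0 ⟩
  Y                  ≡⟨ Y≡ ⟩
  k * (λ' * n ∸ m)   ∎
  where
  n = suc n'
  open SymbolCounts A isOA k≥2 one
  w = outside ones
  M = sum w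
  Y = ∑[ r < N ] (w r * weight r)
  V = ∑[ r < N ] (w r * (weight r * weight r))
  M+m : M + m ≡ N
  M+m = ∑-outside-count ones inj
  Y+mk : Y + m * k ≡ k * (λ' * n)
  Y+mk = trans (∑-outside ones inj weight k (λ i → constant-row (ones i) (all-ones i))) first-moment
  V+mk²+kλ : V + m * (k * k) + k * λ' ≡ k * (k * λ' + λ' * n)
  V+mk²+kλ = trans (cong (_+ k * λ') (∑-outside ones inj (λ r → weight r * weight r) (k * k)
    (λ i → cong₂ _*_ (constant-row (ones i) (all-ones i)) (constant-row (ones i) (all-ones i))))) second-moment
  w-r≢0 : w r ≢ 0
  w-r≢0 = subst (λ t → 1 ∸ t ≢ 0) (sym (multiplicity≡0 ones r not-one)) (λ ())
  N∸m≡M : N ∸ m ≡ M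
  N∸m≡M = trans (cong (_∸ m) (sym M+m)) (m+n∸n≡m M m)
  Y≡ : Y ≡ k * (λ' * n ∸ m)
  Y≡ = begin
    Y                        ≡⟨ sym (m+n∸n≡m Y (m * k)) ⟩
    Y + m * k ∸ m * k        ≡⟨ cong₂ _∸_ Y+mk (*-comm m k) ⟩
    k * (λ' * n) ∸ k * m     ≡⟨ sym (*-distribˡ-∸ k (λ' * n) m) ⟩
    k * (λ' * n ∸ m)         ∎
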